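{- Let $N$ be a $k$-commodity network with source $s$ and sink $t$, and let $C_i, C_j$ be two $s$--$t$ cuts of $N$, each regarded as its set of oriented arcs. Then for every flow $\phi$ on $N$, the flow value of $\phi$ lies in the pairwise capacity \[ U_P(C_i,C_j) = v(C_i \cap C_j) + \big(v(C_i \setminus C_j) \cap v(C_j \setminus C_i)\big). \]
   Context: A $k$-commodity network $N$ is a directed graph with node set $V$, arc set $E$, a source $s$ and a sink $t$, where each arc $a$ has a capacity $C_a \subseteq \mathbb{R}^k$. An arc $(u,v)$ with capacity $C$ may equivalently be regarded as the oppositely oriented arc $(v,u)$ with capacity $-C$. The network is enhanced by an extra arc $e$ from $t$ to $s$ with capacity $\{x \in \mathbb{R}^k : x_i \ge 0 \text{ for all } i\}$. A flow is a map $\phi$ from $E \cup \{e\}$ to $\mathbb{R}^k$ such that at every node the sum of $\phi$ over arcs leaving the node equals the sum over arcs entering it (including $e$), and $\phi(a) \in C_a$ for every arc $a$; its flow value is $\phi(e)$. An $s$--$t$ cut is a partition $V = S \sqcup T$ with $s \in S$, $t \in T$; its (oriented) arc set consists of the arcs of $E$ from $S$ to $T$ in their original orientation and the arcs of $E$ from $T$ to $S$ in the opposite orientation (capacity negated, flow value negated). The arc $e$ is excluded from capacity computations. For a set $A$ of oriented arcs, $v(A)$ is the Minkowski sum of the capacities of the arcs in $A$ (with $v(\emptyset)=\{0\}$); $+$ denotes Minkowski sum. -}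

module Defs where

open import Level using (Level; _⊔_; Lift) renaming (suc to lsuc)
open import Algebra.Bundles using (AbelianGroup)
open import Data.Nat using (ℕ)
open import Data.Fin using (Fin; _≟_)
open import Data.Fin.Subset using (Subset)
open import Data.Vec using (lookup)
open import Data.Bool using (Bool; true; false; if_then_else_)
open import Data.Maybe using (Maybe; just; nothing)
open import Data.List using (List; []; _∷_; foldr; map; concatMap)
open import Data.List.Base using (allFin)
open import Data.Product using (_×_; _,_; ∃; ∃₂; Σ)
open import Relation.Nullary using (does)
open import Relation.Binary.PropositionalEquality using (_≡_)

-- Orientation of an arc relative to a cut: from S to T (fwd) or from T to S (bwd).
data Dir : Set where
  fwd bwd : Dir

sameDir : Dir → Dir → Bool
sameDir fwd fwd = true
sameDir bwd bwd = true
sameDir _   _   = false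

-- Everything is parametrised by an abelian group G playing the role of (ℝ,+);
-- vectors in G^k are functions Fin k → Carrier.
module _ {c ℓ : Level} (G : AbelianGroup c ℓ) where
  open AbelianGroup G renaming (Carrier to A; _∙_ to _+_; ε to 0#; _⁻¹ to -_)

  Vecᵏ : ℕ → Set c
  Vecᵏ k = Fin k → A

  _≈ᵏ_ : {k : ℕ} → Vecᵏ k → Vecᵏ k → Set ℓ
  x ≈ᵏ y = ∀ i → x i ≈ y i

  _+ᵏ_ : {k : ℕ} → Vecᵏ k → Vecᵏ k → Vecᵏ k
  (x +ᵏ y) i = x i + y i

  0ᵏ : {k : ℕ} → Vecᵏ k
  0ᵏ i = 0#

  -ᵏ_ : {k : ℕ} → Vecᵏ k → Vecᵏ k
  (-ᵏ x) i = - (x i)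

  sumᵏ : {k : ℕ} → List (Vecᵏ k) → Vecᵏ k
  sumᵏ = foldr _+ᵏ_ 0ᵏ

  record Network (k : ℕ) (p : Level) : Set (c ⊔ lsuc p) where
    field
      nodes : ℕ
      arcs  : ℕ
      tail  : Fin arcs → Fin nodes
      head  : Fin arcs → Fin nodes
      s     : Fin nodes
      t     : Fin nodes
      cap   : Fin arcs → Vecᵏ k → Set p

  module _ {k : ℕ} {p : Level} (N : Network k p) where
    open Network N

    -- Total flow leaving / entering node u; the extra arc e goes from t to s
    -- and carries the flow value φe.
    outflow : (Fin arcs → Vecᵏ k) → Vecᵏ k → Fin nodes → Vecᵏ k
    outflow φ φe u =
      sumᵏ (map (λ a → if does (tail a ≟ u) then φ a else 0ᵏ) (allFin arcs))
      +ᵏ (if does (t ≟ u) then φe else 0ᵏ)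

    inflow : (Fin arcs → Vecᵏ k) → Vecᵏ k → Fin nodes → Vecᵏ k
    inflow φ φe u =
      sumᵏ (map (λ a → if does (head a ≟ u) then φ a else 0ᵏ) (allFin arcs))
      +ᵏ (if does (s ≟ u) then φe else 0ᵏ)

    record IsFlow {r : Level} (_≤_ : A → A → Set r)
                  (φ : Fin arcs → Vecᵏ k) (φe : Vecᵏ k) : Set (c ⊔ ℓ ⊔ p ⊔ r) where
      field
        conservation : ∀ u → outflow φ φe u ≈ᵏ inflow φ φe u
        capacity     : ∀ a → cap a (φ a)
        capacity-e   : ∀ i → 0# ≤ φe i

    record Cut : Set where
      field
        side : Subset nodes
        s∈S  : lookup side s ≡ true
        t∉S  : lookup side t ≡ false

    orient : Cut → Fin arcs → Maybe Dir
    orient C a with lookup (Cut.side C) (tail a) | lookup (Cut.side C) (head a)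
    ... | true  | false = just fwd
    ... | false | true  = just bwd
    ... | _     | _     = nothing

    OArc : Set
    OArc = Fin arcs × Dir

    ocap : OArc → Vecᵏ k → Set (c ⊔ ℓ ⊔ p)
    ocap (a , fwd) x = Lift (c ⊔ ℓ) (cap a x)
    ocap (a , bwd) x = ∃ λ y → cap a y × (x ≈ᵏ (-ᵏ y))

    v : List OArc → Vecᵏ k → Set (c ⊔ ℓ ⊔ p)
    v []       x = Lift (c ⊔ p) (x ≈ᵏ 0ᵏ)
    v (o ∷ os) x = ∃₂ λ y z → ocap o y × v os z × (x ≈ᵏ (y +ᵏ z))

    private
      interStep : Fin arcs → Maybe Dir → Maybe Dir → List OArc
      interStep a (just d) (just d') = if sameDir d d' then (a , d) ∷ [] else []
      interStep a _        _         = []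

      diffStep : Fin arcs → Maybe Dir → Maybe Dir → List OArc
      diffStep a (just d) (just d') = if sameDir d d' then [] else (a , d) ∷ []
      diffStep a (just d) nothing   = (a , d) ∷ []
      diffStep a nothing  _         = []

    cutInter : Cut → Cut → List OArc
    cutInter Ci Cj = concatMap (λ a → interStep a (orient Ci a) (orient Cj a)) (allFin arcs)

    cutDiff : Cut → Cut → List OArc
    cutDiff Ci Cj = concatMap (λ a → diffStep a (orient Ci a) (orient Cj a)) (allFin arcs)

    UP : Cut → Cut → Vecᵏ k → Set (c ⊔ ℓ ⊔ p)
    UP Ci Cj x = ∃₂ λ y z → v (cutInter Ci Cj) y
                          × (v (cutDiff Ci Cj) z × v (cutDiff Cj Ci) z)
                          × (x ≈ᵏ (y +ᵏ z))

-- Summing the conservation law over the source side of an s–t cut shows that the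
-- flow value equals the net flow across the cut, i.e. the sum of φ along its
-- oriented arcs, which lies in v of the cut. Each oriented arc of Ci either is an
-- oriented arc of Cj too or lies in Ci ∖ Cj, so the value is y + z with
-- y ∈ v(Ci ∩ Cj) and z ∈ v(Ci ∖ Cj); the same split for Cj gives y + z′ with
-- z′ ∈ v(Cj ∖ Ci), and cancelling y shows z′ = z.
module Submission where

open import Defs
open import Level using (Level; lift)
open import Algebra.Bundles using (CommutativeMonoid; AbelianGroup)
import Algebra.Construct.Pointwise as Pointwise
import Algebra.Properties.CommutativeMonoid.Sum as CommutativeMonoidSum
import Algebra.Properties.Group as GroupProperties
open import Data.Nat using (ℕ; zero; suc)
open import Data.Fin using (Fin; zero; suc; _≟_)
open import Data.Bool using (Bool; true; false; if_then_else_)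
open import Data.Maybe using (Maybe; just; nothing)
open import Data.List using (List; []; _∷_; _++_; foldr; map; concatMap; tabulate; allFin)
open import Data.List.Properties using (concatMap-cong)
open import Data.Product using (_,_)
open import Data.Vec using (lookup)
open import Function using (id; _∘_)
open import Relation.Nullary using (does)
open import Relation.Binary.PropositionalEquality as ≡ using (_≡_)
import Relation.Binary.Reasoning.Setoid as SetoidReasoning

module FiniteSums {a ℓ} (M : CommutativeMonoid a ℓ) where
  open CommutativeMonoid M
  open CommutativeMonoidSum M public using (sum; sum-syntax; ∑-distrib-+; sum-cong-≋)
  open CommutativeMonoidSum M using (∑-comm; sum-cong-≗; sum-replicate-zero)
  open SetoidReasoning setoid

  ∑ˡ : {B : Set} → List B → (B → Carrier) → Carrier
  ∑ˡ xs f = foldr _∙_ ε (map f xs)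

  ∑ˡ-++ : {B : Set} (xs ys : List B) (f : B → Carrier) → ∑ˡ (xs ++ ys) f ≈ ∑ˡ xs f ∙ ∑ˡ ys f
  ∑ˡ-++ []       ys f = sym (identityˡ _)
  ∑ˡ-++ (x ∷ xs) ys f = trans (∙-congˡ (∑ˡ-++ xs ys f)) (sym (assoc _ _ _))

  ∑ˡ-tabulate : {B : Set} {n : ℕ} (g : Fin n → B) (f : B → Carrier) → ∑ˡ (tabulate g) f ≡ sum (f ∘ g)
  ∑ˡ-tabulate {n = zero}  g f = ≡.refl
  ∑ˡ-tabulate {n = suc n} g f = ≡.cong (f (g zero) ∙_) (∑ˡ-tabulate (g ∘ suc) f)

  ∑ˡ-concatMap : {B C : Set} (F : B → List C) (xs : List B) (f : C → Carrier) →
                 ∑ˡ (concatMap F xs) f ≈ ∑ˡ xs (λ x → ∑ˡ (F x) f)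
  ∑ˡ-concatMap F []       f = refl
  ∑ˡ-concatMap F (x ∷ xs) f = trans (∑ˡ-++ (F x) (concatMap F xs) f) (∙-congˡ (∑ˡ-concatMap F xs f))

  ∑ˡ-concatMap-allFin : {C : Set} {n : ℕ} (F : Fin n → List C) (f : C → Carrier) →
                        ∑ˡ (concatMap F (allFin n)) f ≈ ∑[ i < n ] ∑ˡ (F i) f
  ∑ˡ-concatMap-allFin F f =
    trans (∑ˡ-concatMap F (allFin _) f) (reflexive (∑ˡ-tabulate id (λ i → ∑ˡ (F i) f)))

  ∑-∑ˡ-split : {C : Set} {n : ℕ} (F I D : Fin n → List C) (f : C → Carrier) →
               (∀ i → F i ≡ I i ++ D i) →
               ∑[ i < n ] ∑ˡ (F i) f ≈ ∑ˡ (concatMap I (allFin n)) f ∙ ∑ˡ (concatMap D (allFin n)) f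
  ∑-∑ˡ-split {n = n} F I D f F≡I++D = begin
    ∑[ i < n ] ∑ˡ (F i) f                           ≈⟨ sum-cong-≋ {n} split ⟩
    ∑[ i < n ] (∑ˡ (I i) f ∙ ∑ˡ (D i) f)            ≈⟨ ∑-distrib-+ (λ i → ∑ˡ (I i) f) (λ i → ∑ˡ (D i) f) ⟩
    ∑[ i < n ] ∑ˡ (I i) f ∙ ∑[ i < n ] ∑ˡ (D i) f   ≈⟨ ∙-cong (∑ˡ-concatMap-allFin I f) (∑ˡ-concatMap-allFin D f) ⟨
    ∑ˡ (concatMap I (allFin n)) f ∙ ∑ˡ (concatMap D (allFin n)) f ∎
    where
    split : ∀ i → ∑ˡ (F i) f ≈ ∑ˡ (I i) f ∙ ∑ˡ (D i) f
    split i = trans (reflexive (≡.cong (λ xs → ∑ˡ xs f) (F≡I++D i))) (∑ˡ-++ (I i) (D i) f)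

  if-∙ : ∀ b x y → (if b then x ∙ y else ε) ≈ (if b then x else ε) ∙ (if b then y else ε)
  if-∙ true  x y = refl
  if-∙ false x y = sym (identityˡ ε)

  if-cong : ∀ b {x y} → x ≈ y → (if b then x else ε) ≈ (if b then y else ε)
  if-cong true  x≈y = x≈y
  if-cong false x≈y = refl

  if-if-comm : ∀ b b′ x → (if b then (if b′ then x else ε) else ε) ≡ (if b′ then (if b then x else ε) else ε)
  if-if-comm true  b′    x = ≡.refl
  if-if-comm false true  x = ≡.refl
  if-if-comm false false x = ≡.refl

  if-sum : ∀ b {n} (f : Fin n → Carrier) → (if b then sum f else ε) ≈ ∑[ i < n ] (if b then f i else ε)
  if-sum true      f = refl
  if-sum false {n} f = sym (sum-replicate-zero n)

  sum-δ : ∀ {n} (w : Fin n) (h : Fin n → Carrier) → ∑[ u < n ] (if does (w ≟ u) then h u else ε) ≈ h w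
  sum-δ {suc n} zero    h = trans (∙-congˡ (sum-replicate-zero n)) (identityʳ _)
  sum-δ {suc n} (suc w) h = trans (identityˡ _) (sum-δ w (h ∘ suc))

  ∑-restrict-fibres : ∀ {m n} (χ : Fin n → Bool) (end : Fin m → Fin n) (x : Fin m → Carrier) →
    ∑[ u < n ] (if χ u then ∑[ a < m ] (if does (end a ≟ u) then x a else ε) else ε)
    ≈ ∑[ a < m ] (if χ (end a) then x a else ε)
  ∑-restrict-fibres {m} {n} χ end x = begin
    ∑[ u < n ] (if χ u then ∑[ a < m ] (if does (end a ≟ u) then x a else ε) else ε)
      ≈⟨ sum-cong-≋ {n} (λ u → if-sum (χ u) (λ a → if does (end a ≟ u) then x a else ε)) ⟩
    ∑[ u < n ] ∑[ a < m ] (if χ u then (if does (end a ≟ u) then x a else ε) else ε)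
      ≈⟨ ∑-comm (λ u a → if χ u then (if does (end a ≟ u) then x a else ε) else ε) ⟩
    ∑[ a < m ] ∑[ u < n ] (if χ u then (if does (end a ≟ u) then x a else ε) else ε)
      ≡⟨ sum-cong-≗ {m} (λ a → sum-cong-≗ {n} (λ u → if-if-comm (χ u) (does (end a ≟ u)) (x a))) ⟩
    ∑[ a < m ] ∑[ u < n ] (if does (end a ≟ u) then (if χ u then x a else ε) else ε)
      ≈⟨ sum-cong-≋ {m} (λ a → sum-δ (end a) (λ u → if χ u then x a else ε)) ⟩
    ∑[ a < m ] (if χ (end a) then x a else ε) ∎

  ∑-restrict-incidence : ∀ {m n} (χ : Fin n → Bool) (end : Fin m → Fin n) (x : Fin m → Carrier)
    (w : Fin n) (y : Carrier) →
    ∑[ u < n ] (if χ u then ∑ˡ (allFin m) (λ a → if does (end a ≟ u) then x a else ε)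
                            ∙ (if does (w ≟ u) then y else ε) else ε)
    ≈ ∑[ a < m ] (if χ (end a) then x a else ε) ∙ (if χ w then y else ε)
  ∑-restrict-incidence {m} {n} χ end x w y = begin
    ∑[ u < n ] (if χ u then X u ∙ Y u else ε)
      ≈⟨ sum-cong-≋ {n} (λ u → if-∙ (χ u) (X u) (Y u)) ⟩
    ∑[ u < n ] ((if χ u then X u else ε) ∙ (if χ u then Y u else ε))
      ≈⟨ ∑-distrib-+ (λ u → if χ u then X u else ε) (λ u → if χ u then Y u else ε) ⟩
    ∑[ u < n ] (if χ u then X u else ε) ∙ ∑[ u < n ] (if χ u then Y u else ε)
      ≈⟨ ∙-cong arcs-part extra-part ⟩
    ∑[ a < m ] (if χ (end a) then x a else ε) ∙ (if χ w then y else ε) ∎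
    where
    X : Fin n → Carrier
    X u = ∑ˡ (allFin m) (λ a → if does (end a ≟ u) then x a else ε)
    Y : Fin n → Carrier
    Y u = if does (w ≟ u) then y else ε
    arcs-part : ∑[ u < n ] (if χ u then X u else ε) ≈ ∑[ a < m ] (if χ (end a) then x a else ε)
    arcs-part = trans (reflexive (sum-cong-≗ {n} (λ u → ≡.cong (λ s → if χ u then s else ε) (X≡sum u))))
                      (∑-restrict-fibres χ end x)
      where
      X≡sum : ∀ u → X u ≡ ∑[ a < m ] (if does (end a ≟ u) then x a else ε)
      X≡sum u = ∑ˡ-tabulate id (λ a → if does (end a ≟ u) then x a else ε)
    extra-part : ∑[ u < n ] (if χ u then Y u else ε) ≈ (if χ w then y else ε)
    extra-part = trans (reflexive (sum-cong-≗ {n} (λ u → if-if-comm (χ u) (does (w ≟ u)) y)))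
                       (sum-δ w (λ u → if χ u then y else ε))

module OrientedArcs {c ℓ p : Level} (G : AbelianGroup c ℓ) {k : ℕ} (N : Network G k p) where
  open Network N

  crossing : Fin arcs → Maybe Dir → List (OArc G N)
  crossing a (just d) = (a , d) ∷ []
  crossing a nothing  = []

  interStep : Fin arcs → Maybe Dir → Maybe Dir → List (OArc G N)
  interStep a (just d) (just d′) = if sameDir d d′ then (a , d) ∷ [] else []
  interStep a _        _         = []

  diffStep : Fin arcs → Maybe Dir → Maybe Dir → List (OArc G N)
  diffStep a (just d) (just d′) = if sameDir d d′ then [] else (a , d) ∷ []
  diffStep a (just d) nothing   = (a , d) ∷ []
  diffStep a nothing  _         = []

  crossing-splitˡ : ∀ a x y → crossing a x ≡ interStep a x y ++ diffStep a x y
  crossing-splitˡ a (just fwd) (just fwd) = ≡.refl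
  crossing-splitˡ a (just fwd) (just bwd) = ≡.refl
  crossing-splitˡ a (just bwd) (just fwd) = ≡.refl
  crossing-splitˡ a (just bwd) (just bwd) = ≡.refl
  crossing-splitˡ a (just d)   nothing    = ≡.refl
  crossing-splitˡ a nothing    y          = ≡.refl

  crossing-splitʳ : ∀ a x y → crossing a y ≡ interStep a x y ++ diffStep a y x
  crossing-splitʳ a (just fwd) (just fwd) = ≡.refl
  crossing-splitʳ a (just fwd) (just bwd) = ≡.refl
  crossing-splitʳ a (just bwd) (just fwd) = ≡.refl
  crossing-splitʳ a (just bwd) (just bwd) = ≡.refl
  crossing-splitʳ a (just d)   nothing    = ≡.refl
  crossing-splitʳ a nothing    (just d)   = ≡.refl
  crossing-splitʳ a nothing    nothing    = ≡.refl

  -- Defs keeps its own interStep and diffStep private, so the left-hand sides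
  -- are left to unification with their occurrences in cutInter and cutDiff.
  interStep≗ : ∀ Ci Cj a → _ ≡ interStep a (orient G N Ci a) (orient G N Cj a)
  diffStep≗  : ∀ Ci Cj a → _ ≡ diffStep a (orient G N Ci a) (orient G N Cj a)

  cutInter≡ : ∀ Ci Cj →
    cutInter G N Ci Cj ≡ concatMap (λ a → interStep a (orient G N Ci a) (orient G N Cj a)) (allFin arcs)
  cutInter≡ Ci Cj = concatMap-cong (interStep≗ Ci Cj) (allFin arcs)

  cutDiff≡ : ∀ Ci Cj →
    cutDiff G N Ci Cj ≡ concatMap (λ a → diffStep a (orient G N Ci a) (orient G N Cj a)) (allFin arcs)
  cutDiff≡ Ci Cj = concatMap-cong (diffStep≗ Ci Cj) (allFin arcs)

  interStep≗ Ci Cj a with orient G N Ci a | orient G N Cj a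
  ... | just _  | just _  = ≡.refl
  ... | just _  | nothing = ≡.refl
  ... | nothing | _       = ≡.refl

  diffStep≗ Ci Cj a with orient G N Ci a | orient G N Cj a
  ... | just _  | just _  = ≡.refl
  ... | just _  | nothing = ≡.refl
  ... | nothing | _       = ≡.refl

module CutFlow {c ℓ p r : Level} (G : AbelianGroup c ℓ)
               {_≤_ : AbelianGroup.Carrier G → AbelianGroup.Carrier G → Set r}
               {k : ℕ} (N : Network G k p)
               {φ : Fin (Network.arcs N) → Vecᵏ G k} {φe : Vecᵏ G k}
               (flow : IsFlow G N _≤_ φ φe) where
  open Network N
  open IsFlow flow
  open OrientedArcs G N

  -- Its operations are definitionally _+ᵏ_, 0ᵏ, -ᵏ_ and _≈ᵏ_ of Defs.
  Gᵏ : AbelianGroup c ℓ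
  Gᵏ = Pointwise.abelianGroup (Fin k) G

  open AbelianGroup Gᵏ
  open GroupProperties group using (∙-cancelʳ)
  open FiniteSums commutativeMonoid
  open SetoidReasoning setoid

  flowAlong : OArc G N → Vecᵏ G k
  flowAlong (a , fwd) = φ a
  flowAlong (a , bwd) = φ a ⁻¹

  netFlow : Cut G N → Vecᵏ G k
  netFlow C = ∑[ a < arcs ] ∑ˡ (crossing a (orient G N C a)) flowAlong

  conservation-restricted : (χ : Fin nodes → Bool) →
    ∑[ a < arcs ] (if χ (tail a) then φ a else ε) ∙ (if χ t then φe else ε)
    ≈ ∑[ a < arcs ] (if χ (head a) then φ a else ε) ∙ (if χ s then φe else ε)
  conservation-restricted χ = begin
    ∑[ a < arcs ] (if χ (tail a) then φ a else ε) ∙ (if χ t then φe else ε)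
      ≈⟨ ∑-restrict-incidence χ tail φ t φe ⟨
    ∑[ u < nodes ] (if χ u then outflow G N φ φe u else ε)
      ≈⟨ sum-cong-≋ {nodes} (λ u → if-cong (χ u) (conservation u)) ⟩
    ∑[ u < nodes ] (if χ u then inflow G N φ φe u else ε)
      ≈⟨ ∑-restrict-incidence χ head φ s φe ⟩
    ∑[ a < arcs ] (if χ (head a) then φ a else ε) ∙ (if χ s then φe else ε) ∎

  crossing-balance : ∀ C a → let χ = lookup (Cut.side C) in
    (if χ (tail a) then φ a else ε)
    ≈ ∑ˡ (crossing a (orient G N C a)) flowAlong ∙ (if χ (head a) then φ a else ε)
  crossing-balance C a with lookup (Cut.side C) (tail a) | lookup (Cut.side C) (head a)
  ... | true  | true  = sym (identityˡ _)
  ... | true  | false = sym (trans (identityʳ _) (identityʳ _))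
  ... | false | true  = sym (trans (∙-congʳ (identityʳ _)) (inverseˡ _))
  ... | false | false = sym (identityˡ ε)

  cut-value : ∀ C → netFlow C ≈ φe
  cut-value C = ∙-cancelʳ (Along head) (netFlow C) φe (begin
    netFlow C ∙ Along head
      ≈⟨ ∑-distrib-+ (λ a → ∑ˡ (crossing a (orient G N C a)) flowAlong) (λ a → if χ (head a) then φ a else ε) ⟨
    ∑[ a < arcs ] (∑ˡ (crossing a (orient G N C a)) flowAlong ∙ (if χ (head a) then φ a else ε))
      ≈⟨ sum-cong-≋ {arcs} (crossing-balance C) ⟨
    Along tail
      ≈⟨ identityʳ _ ⟨
    Along tail ∙ ε
      ≡⟨ ≡.cong (λ b → Along tail ∙ (if b then φe else ε)) (Cut.t∉S C) ⟨
    Along tail ∙ (if χ t then φe else ε)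
      ≈⟨ conservation-restricted χ ⟩
    Along head ∙ (if χ s then φe else ε)
      ≡⟨ ≡.cong (λ b → Along head ∙ (if b then φe else ε)) (Cut.s∈S C) ⟩
    Along head ∙ φe
      ≈⟨ comm _ _ ⟩
    φe ∙ Along head ∎)
    where
    χ : Fin nodes → Bool
    χ = lookup (Cut.side C)
    Along : (Fin arcs → Fin nodes) → Vecᵏ G k
    Along end = ∑[ a < arcs ] (if χ (end a) then φ a else ε)

  netFlow-splitˡ : ∀ Ci Cj →
    netFlow Ci ≈ ∑ˡ (cutInter G N Ci Cj) flowAlong ∙ ∑ˡ (cutDiff G N Ci Cj) flowAlong
  netFlow-splitˡ Ci Cj = begin
    netFlow Ci
      ≈⟨ ∑-∑ˡ-split _ (λ a → interStep a (oi a) (oj a)) (λ a → diffStep a (oi a) (oj a)) flowAlong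
                    (λ a → crossing-splitˡ a (oi a) (oj a)) ⟩
    ∑ˡ (concatMap (λ a → interStep a (oi a) (oj a)) (allFin arcs)) flowAlong
      ∙ ∑ˡ (concatMap (λ a → diffStep a (oi a) (oj a)) (allFin arcs)) flowAlong
      ≡⟨ ≡.cong₂ (λ I D → ∑ˡ I flowAlong ∙ ∑ˡ D flowAlong) (cutInter≡ Ci Cj) (cutDiff≡ Ci Cj) ⟨
    ∑ˡ (cutInter G N Ci Cj) flowAlong ∙ ∑ˡ (cutDiff G N Ci Cj) flowAlong ∎
    where
    oi oj : Fin arcs → Maybe Dir
    oi = orient G N Ci
    oj = orient G N Cj

  netFlow-splitʳ : ∀ Ci Cj →
    netFlow Cj ≈ ∑ˡ (cutInter G N Ci Cj) flowAlong ∙ ∑ˡ (cutDiff G N Cj Ci) flowAlong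
  netFlow-splitʳ Ci Cj = begin
    netFlow Cj
      ≈⟨ ∑-∑ˡ-split _ (λ a → interStep a (oi a) (oj a)) (λ a → diffStep a (oj a) (oi a)) flowAlong
                    (λ a → crossing-splitʳ a (oi a) (oj a)) ⟩
    ∑ˡ (concatMap (λ a → interStep a (oi a) (oj a)) (allFin arcs)) flowAlong
      ∙ ∑ˡ (concatMap (λ a → diffStep a (oj a) (oi a)) (allFin arcs)) flowAlong
      ≡⟨ ≡.cong₂ (λ I D → ∑ˡ I flowAlong ∙ ∑ˡ D flowAlong) (cutInter≡ Ci Cj) (cutDiff≡ Cj Ci) ⟨
    ∑ˡ (cutInter G N Ci Cj) flowAlong ∙ ∑ˡ (cutDiff G N Cj Ci) flowAlong ∎
    where
    oi oj : Fin arcs → Maybe Dir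
    oi = orient G N Ci
    oj = orient G N Cj

  v-∑ˡ-flowAlong : ∀ L → v G N L (∑ˡ L flowAlong)
  v-∑ˡ-flowAlong []              = lift refl
  v-∑ˡ-flowAlong ((a , fwd) ∷ L) = φ a , ∑ˡ L flowAlong , lift (capacity a) , v-∑ˡ-flowAlong L , refl
  v-∑ˡ-flowAlong ((a , bwd) ∷ L) =
    φ a ⁻¹ , ∑ˡ L flowAlong , (φ a , capacity a , refl) , v-∑ˡ-flowAlong L , refl

  v-resp-≈ : ∀ L {x y} → x ≈ y → v G N L x → v G N L y
  v-resp-≈ []      x≈y (lift x≈0)                   = lift (trans (sym x≈y) x≈0)
  v-resp-≈ (o ∷ L) x≈y (y′ , z′ , o∋y′ , L∋z′ , x≈) = y′ , z′ , o∋y′ , L∋z′ , trans (sym x≈y) x≈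

lemma2 : {c ℓ p r : Level} (G : AbelianGroup c ℓ)
         (_≤_ : AbelianGroup.Carrier G → AbelianGroup.Carrier G → Set r)
         {k : ℕ} (N : Network G k p) (Ci Cj : Cut G N)
         (φ : Fin (Network.arcs N) → Vecᵏ G k) (φe : Vecᵏ G k) →
         IsFlow G N _≤_ φ φe → UP G N Ci Cj φe
lemma2 G _≤_ {k} N Ci Cj φ φe flow =
  Y , Z , v-∑ˡ-flowAlong _ , (v-∑ˡ-flowAlong _ , v-resp-≈ _ Z′≈Z (v-∑ˡ-flowAlong _)) , φe≈Y∙Z
  where
  open CutFlow G N flow
  open AbelianGroup Gᵏ using (_≈_; _∙_; sym; trans; group; commutativeMonoid)
  open GroupProperties group using (∙-cancelˡ)
  open FiniteSums commutativeMonoid using (∑ˡ)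
  Y Z Z′ : Vecᵏ G k
  Y  = ∑ˡ (cutInter G N Ci Cj) flowAlong
  Z  = ∑ˡ (cutDiff G N Ci Cj) flowAlong
  Z′ = ∑ˡ (cutDiff G N Cj Ci) flowAlong
  φe≈Y∙Z : φe ≈ Y ∙ Z
  φe≈Y∙Z = trans (sym (cut-value Ci)) (netFlow-splitˡ Ci Cj)
  φe≈Y∙Z′ : φe ≈ Y ∙ Z′
  φe≈Y∙Z′ = trans (sym (cut-value Cj)) (netFlow-splitʳ Ci Cj)
  Z′≈Z : Z′ ≈ Z
  Z′≈Z = ∙-cancelˡ Y Z′ Z (trans (sym φe≈Y∙Z′) φe≈Y∙Z)
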